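{- Let $\mathcal A$ be the class of all finite natural anti-metric spaces and $\sigma\mathcal A$ the class of all countable natural anti-metric spaces. No countably infinite natural anti-metric space $X$ is an amalgamation base in $\sigma\mathcal A$.
   Context: A natural anti-metric space is a pair $(X,\rho)$ where $\rho:X^2\to\mathbb N$ is symmetric, $\rho(x,y)=0$ iff $x=y$, and for all pairwise distinct $x,y,z\in X$, if $\rho(x,y)\ge\max\{\rho(x,z),\rho(z,y)\}$ then $\rho(x,y)>\rho(x,z)+\rho(z,y)$. Embeddings are injective maps preserving $\rho$. $X\in\sigma\mathcal A$ is an amalgamation base in $\sigma\mathcal A$ if for all embeddings $f:X\to Y$, $g:X\to Z$ with $Y,Z\in\sigma\mathcal A$ there exist $W\in\sigma\mathcal A$ and embeddings $f':Y\to W$, $g':Z\to W$ with $f'\circ f=g'\circ g$. -}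

module Defs where

open import Data.Nat using (ℕ; _≤_; _<_; _+_; _⊔_)
open import Data.Product using (Σ; _×_; _,_; ∃-syntax)
open import Function.Bundles using (_↣_; _⤖_)
open import Function.Definitions using (Injective)
open import Relation.Binary.PropositionalEquality using (_≡_)
open import Relation.Nullary using (¬_)
open import Level using (0ℓ) renaming (suc to lsuc)

record AntiMetric : Set₁ where
  field
    Carrier : Set
    ρ       : Carrier → Carrier → ℕ
    sym     : ∀ x y → ρ x y ≡ ρ y x
    zero⇔   : ∀ x y → (ρ x y ≡ 0 → x ≡ y) × (x ≡ y → ρ x y ≡ 0)
    anti    : ∀ x y z → ¬ x ≡ y → ¬ x ≡ z → ¬ z ≡ y →
              (ρ x z ⊔ ρ z y) ≤ ρ x y → (ρ x z + ρ z y) < ρ x y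

open AntiMetric public

-- Membership in σ𝒜: countable (finite or countably infinite) = injects into ℕ.
Countable : AntiMetric → Set
Countable X = Carrier X ↣ ℕ

CountablyInfinite : AntiMetric → Set
CountablyInfinite X = Carrier X ⤖ ℕ

record Embedding (X Y : AntiMetric) : Set where
  field
    map      : Carrier X → Carrier Y
    injective : Injective _≡_ _≡_ map
    preserves : ∀ x y → ρ Y (map x) (map y) ≡ ρ X x y

open Embedding public

IsAmalgamationBaseσ : AntiMetric → Set₁
IsAmalgamationBaseσ X =
  ∀ (Y Z : AntiMetric) → Countable Y → Countable Z →
  (f : Embedding X Y) (g : Embedding X Z) →
  Σ AntiMetric λ W → Countable W × 
  Σ (Embedding Y W) λ f' → Σ (Embedding Z W) λ g' →
    ∀ x → map f' (map f x) ≡ map g' (map g x)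

-- Along an enumeration x₀, x₁, … of X choose heights h(xₙ) ≥ n so large that
-- h(xᵢ) + ρ(xᵢ, xₙ) < h(xₙ) for i < n. Then both suc ∘ h and suc ∘ suc ∘ h are
-- admissible distances from one new point to X.
-- Amalgamating the two resulting one-point extensions of X would give points
-- p, q with ρ(p, y) = 1 + h y and ρ(q, y) = 2 + h y for every y from X. Taking y
-- with h y ≥ ρ(q, p), the anti-triangle inequality on q, y, p forces
-- ρ(q, p) = 0, although p ≠ q.
module Submission where

open import Defs hiding (sym)
open import Relation.Nullary using (¬_)
open import Data.Nat using (ℕ; zero; suc; _≤_; _<_; _+_; _⊔_; s≤s)
open import Data.Nat.Properties
open import Data.Maybe using (Maybe; nothing; just)
open import Data.Product using (Σ; _×_; _,_; proj₁; proj₂)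
open import Data.Sum using (inj₁; inj₂)
open import Data.Empty using (⊥; ⊥-elim)
open import Function using (_∘_)
open import Function.Bundles using (_↣_; mk↣; Injection; Bijection)
open import Relation.Binary.PropositionalEquality
open import Relation.Binary.Definitions using (tri<; tri≈; tri>)

maybe-↣ℕ : {A : Set} → A ↣ ℕ → Maybe A ↣ ℕ
maybe-↣ℕ c = mk↣ {to = code} code-injective
  where
  open Injection c using () renaming (to to index; injective to index-injective)

  code : Maybe _ → ℕ
  code nothing  = 0
  code (just u) = suc (index u)

  code-injective : ∀ {x y} → code x ≡ code y → x ≡ y
  code-injective {nothing} {nothing} _ = refl
  code-injective {just u}  {just v}  e = cong just (index-injective (suc-injective e))

record Spread (X : AntiMetric) (h : Carrier X → ℕ) : Set where
  field
    gap : ∀ u v → ¬ u ≡ v → h u ≤ h v → h u + ρ X u v < h v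

open Spread

suc-spread : ∀ {X h} → Spread X h → Spread X (suc ∘ h)
suc-spread spread .gap u v u≢v (s≤s hu≤hv) = s≤s (spread .gap u v u≢v hu≤hv)

Unbounded : {A : Set} → (A → ℕ) → Set
Unbounded {A} h = ∀ n → Σ A λ u → n ≤ h u

module Ladder (d : ℕ → ℕ → ℕ) where

  column : ℕ → ℕ → ℕ
  column zero    m = 0
  column (suc n) m = column n m + d n m

  ladder : ℕ → ℕ
  ladder zero    = 0
  ladder (suc n) = suc (ladder n + column (suc n) (suc n))

  d≤column : ∀ {i n} m → i < n → d i m ≤ column n m
  d≤column {i} {suc n} m (s≤s i≤n) with m≤n⇒m<n∨m≡n i≤n
  ... | inj₁ i<n  = ≤-trans (d≤column m i<n) (m≤m+n (column n m) (d n m))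
  ... | inj₂ refl = m≤n+m (d n m) (column n m)

  ladder-gap : ∀ {i j} → i < j → ladder i + d i j < ladder j
  ladder-gap {i} {suc n} i<1+n =
    s≤s (+-mono-≤ ladder-i≤ladder-n (d≤column (suc n) i<1+n))
    where
    ladder-i≤ladder-n : ladder i ≤ ladder n
    ladder-i≤ladder-n with m≤n⇒m<n∨m≡n (≤-pred i<1+n)
    ... | inj₁ i<n  = ≤-trans (m≤m+n (ladder i) (d i n)) (<⇒≤ (ladder-gap i<n))
    ... | inj₂ refl = ≤-refl

  n≤ladder : ∀ n → n ≤ ladder n
  n≤ladder zero    = ≤-refl
  n≤ladder (suc n) = s≤s (≤-trans (n≤ladder n) (m≤m+n (ladder n) _))

countablyInfinite⇒unbounded-spread : ∀ X → CountablyInfinite X →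
  Σ (Carrier X → ℕ) λ h → Spread X h × Unbounded h
countablyInfinite⇒unbounded-spread X ω = h , spread , unbounded
  where
  open Bijection ω using (to; to⁻; strictlySurjective) renaming (injective to to-injective)
  open Ladder (λ i j → ρ X (to⁻ i) (to⁻ j))

  to∘to⁻ : ∀ n → to (to⁻ n) ≡ n
  to∘to⁻ = proj₂ ∘ strictlySurjective

  to⁻∘to : ∀ u → to⁻ (to u) ≡ u
  to⁻∘to u = to-injective (to∘to⁻ (to u))

  h : Carrier X → ℕ
  h = ladder ∘ to

  h-gap : ∀ u v → to u < to v → h u + ρ X u v < h v
  h-gap u v lt = subst₂ (λ u′ v′ → h u + ρ X u′ v′ < h v) (to⁻∘to u) (to⁻∘to v) (ladder-gap lt)

  spread : Spread X h
  spread .gap u v u≢v hu≤hv with <-cmp (to u) (to v)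
  ... | tri< lt _ _ = h-gap u v lt
  ... | tri≈ _ eq _ = ⊥-elim (u≢v (to-injective eq))
  ... | tri> _ _ gt = ⊥-elim (<⇒≱ (≤-<-trans (m≤m+n (h v) _) (h-gap v u gt)) hu≤hv)

  unbounded : Unbounded h
  unbounded n = to⁻ n , subst (λ m → n ≤ ladder m) (sym (to∘to⁻ n)) (n≤ladder n)

module _ (X : AntiMetric) (h : Carrier X → ℕ) (spread : Spread X h) where

  ρ⁺ : Maybe (Carrier X) → Maybe (Carrier X) → ℕ
  ρ⁺ nothing  nothing  = 0
  ρ⁺ nothing  (just v) = suc (h v)
  ρ⁺ (just u) nothing  = suc (h u)
  ρ⁺ (just u) (just v) = ρ X u v

  private
    ρ⁺-sym : ∀ x y → ρ⁺ x y ≡ ρ⁺ y x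
    ρ⁺-sym nothing  nothing  = refl
    ρ⁺-sym nothing  (just v) = refl
    ρ⁺-sym (just u) nothing  = refl
    ρ⁺-sym (just u) (just v) = AntiMetric.sym X u v

    ρ⁺-zero⇔ : ∀ x y → (ρ⁺ x y ≡ 0 → x ≡ y) × (x ≡ y → ρ⁺ x y ≡ 0)
    ρ⁺-zero⇔ nothing  nothing  = (λ _ → refl) , (λ _ → refl)
    ρ⁺-zero⇔ nothing  (just v) = (λ ()) , (λ ())
    ρ⁺-zero⇔ (just u) nothing  = (λ ()) , (λ ())
    ρ⁺-zero⇔ (just u) (just v) =
      cong just ∘ proj₁ (zero⇔ X u v) , λ { refl → proj₂ (zero⇔ X u u) refl }

    just-≢ : ∀ {u v : Carrier X} → ¬ just u ≡ just v → ¬ u ≡ v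
    just-≢ ne refl = ne refl

    spread⁺ : Spread X (suc ∘ h)
    spread⁺ = suc-spread spread

    -- The gap makes one of the distances to the new point exceed ρ u v.
    far-pair : ∀ u v → ¬ u ≡ v → suc (h u) ⊔ suc (h v) ≤ ρ X u v → ⊥
    far-pair u v u≢v bound with ≤-total (h u) (h v)
    ... | inj₁ le =
      <⇒≱ (≤-<-trans (m≤n+m _ (suc (h u))) (spread⁺ .gap u v u≢v (s≤s le)))
          (≤-trans (m≤n⊔m (suc (h u)) _) bound)
    ... | inj₂ le =
      <⇒≱ (≤-<-trans (m≤n+m _ (suc (h v))) (spread⁺ .gap v u (u≢v ∘ sym) (s≤s le)))
          (subst (suc (h u) ≤_) (AntiMetric.sym X u v)
                 (≤-trans (m≤m⊔n (suc (h u)) (suc (h v))) bound))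

    ρ⁺-anti : ∀ x y z → ¬ x ≡ y → ¬ x ≡ z → ¬ z ≡ y →
              ρ⁺ x z ⊔ ρ⁺ z y ≤ ρ⁺ x y → ρ⁺ x z + ρ⁺ z y < ρ⁺ x y
    ρ⁺-anti nothing  nothing  _        x≢y _   _   _ = ⊥-elim (x≢y refl)
    ρ⁺-anti nothing  (just y) nothing  _   x≢z _   _ = ⊥-elim (x≢z refl)
    ρ⁺-anti (just x) nothing  nothing  _   _   z≢y _ = ⊥-elim (z≢y refl)
    ρ⁺-anti (just x) (just y) (just z) x≢y x≢z z≢y bound =
      anti X x y z (just-≢ x≢y) (just-≢ x≢z) (just-≢ z≢y) bound
    ρ⁺-anti nothing  (just y) (just z) _   _   z≢y bound =
      spread⁺ .gap z y (just-≢ z≢y) (≤-trans (m≤m⊔n (suc (h z)) (ρ X z y)) bound)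
    ρ⁺-anti (just x) nothing  (just z) _   x≢z _   bound =
      subst (_< suc (h x)) (trans (cong (suc (h z) +_) (AntiMetric.sym X z x)) (+-comm (suc (h z)) _))
        (spread⁺ .gap z x (just-≢ (x≢z ∘ sym)) (≤-trans (m≤n⊔m _ _) bound))
    ρ⁺-anti (just x) (just y) nothing  x≢y _   _   bound =
      ⊥-elim (far-pair x y (just-≢ x≢y) bound)

  extension : AntiMetric
  extension = record
    { Carrier = Maybe (Carrier X)
    ; ρ       = ρ⁺
    ; sym     = ρ⁺-sym
    ; zero⇔   = ρ⁺-zero⇔
    ; anti    = ρ⁺-anti
    }

  just-embedding : Embedding X extension
  just-embedding = record
    { map       = just
    ; injective = λ { refl → refl }
    ; preserves = λ _ _ → refl
    }

no-unit-step : ∀ W (p q y : Carrier W) → ρ W q p ≤ ρ W p y → ¬ ρ W q y ≡ suc (ρ W p y)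
no-unit-step W p q y near step =
  ρqp≢0 (n≤0⇒n≡0 (+-cancelʳ-≤ (d p y) (d q p) 0 (≤-pred (subst (d q p + d p y <_) step anti-step))))
  where
  open Defs.AntiMetric W using () renaming (ρ to d)

  p≢q : ¬ p ≡ q
  p≢q refl = 1+n≢n (sym step)

  q≢y : ¬ q ≡ y
  q≢y refl = 0≢1+n (trans (sym (proj₂ (zero⇔ W q q) refl)) step)

  ρqp≢0 : ¬ d q p ≡ 0
  ρqp≢0 = p≢q ∘ sym ∘ proj₁ (zero⇔ W q p)

  p≢y : ¬ p ≡ y
  p≢y refl = ρqp≢0 (n≤0⇒n≡0 (subst (d q p ≤_) (proj₂ (zero⇔ W p p) refl) near))

  anti-step : d q p + d p y < d q y
  anti-step = anti W q y p q≢y (p≢q ∘ sym) p≢y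
    (subst (d q p ⊔ d p y ≤_) (sym step) (⊔-lub (m≤n⇒m≤1+n near) (n≤1+n _)))

unbounded-spread⇒¬amalgamation-base : ∀ X h (spread : Spread X h) → Unbounded h →
  Countable X → ¬ IsAmalgamationBaseσ X
unbounded-spread⇒¬amalgamation-base X h spread unbounded countable isBase
  with isBase (extension X h spread) (extension X (suc ∘ h) (suc-spread spread))
              (maybe-↣ℕ countable) (maybe-↣ℕ countable)
              (just-embedding X _ _) (just-embedding X _ _)
... | W , _ , f , g , commute = no-unit-step W p q y near step
  where
  p q : Carrier W
  p = map f nothing
  q = map g nothing

  u : Carrier X
  u = proj₁ (unbounded (ρ W q p))

  y : Carrier W
  y = map f (just u)

  ρpy≡ : ρ W p y ≡ suc (h u)
  ρpy≡ = preserves f nothing (just u)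

  near : ρ W q p ≤ ρ W p y
  near = subst (ρ W q p ≤_) (sym ρpy≡) (m≤n⇒m≤1+n (proj₂ (unbounded (ρ W q p))))

  step : ρ W q y ≡ suc (ρ W p y)
  step = begin
    ρ W q y                  ≡⟨ cong (ρ W q) (commute u) ⟩
    ρ W q (map g (just u))   ≡⟨ preserves g nothing (just u) ⟩
    suc (suc (h u))          ≡⟨ cong suc ρpy≡ ⟨
    suc (ρ W p y)            ∎
    where open ≡-Reasoning

proposition5p2 : (X : AntiMetric) → CountablyInfinite X → ¬ IsAmalgamationBaseσ X
proposition5p2 X ω =
  let h , spread , unbounded = countablyInfinite⇒unbounded-spread X ω
  in  unbounded-spread⇒¬amalgamation-base X h spread unbounded (Bijection.injection ω)
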